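{- Let $n\geqslant 3$ and let $P_n$ be the path graph on $n$ vertices. Then (i) $\phi_{\min}(P_n)=0$ and (ii) $\phi_{\max}(P_n)=\lceil n/2\rceil-1$.
   Context: All graphs are finite, simple and undirected. A numbering of a graph $G$ with $n$ vertices is a bijection $\pi:V(G)\to\{1,\dots,n\}$. A 2-path $\langle x,u,y\rangle$ of $G$ consists of a middle vertex $u$ and an unordered pair $\{x,y\}$ of two distinct neighbours of $u$ (the endpoints $x,y$ may or may not be adjacent). Given a numbering $\pi$, the 2-path $\langle x,u,y\rangle$ is valid if $\pi(u)<\min(\pi(x),\pi(y))$. The validity $\phi_\pi(G)$ is the number of valid 2-paths of $G$ under $\pi$; $\phi_{\min}(G)$ and $\phi_{\max}(G)$ are the minimum and maximum of $\phi_\pi(G)$ over all numberings $\pi$ of $G$. -}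

module Defs where

open import Data.Nat using (ℕ; zero; suc; _+_; _<_; _≤_)
open import Data.Product using (Σ; _×_; _,_)
open import Data.Fin as Fin using ()
open import Data.Nat.Properties using (_<?_; _≟_; suc-injective)
open import Data.Fin using (Fin; toℕ)
open import Data.Fin.Permutation using (Permutation′; _⟨$⟩ʳ_)
open import Data.Sum using (_⊎_; inj₁; inj₂)
open import Data.Empty using (⊥)
open import Relation.Binary.PropositionalEquality using (_≡_; refl; sym)
open import Relation.Nullary using (Dec; yes; no; ¬_)
open import Relation.Nullary.Decidable using (_×-dec_; _⊎-dec_)

record Graph (n : ℕ) : Set₁ where
  field
    Adj    : Fin n → Fin n → Set
    adj?   : ∀ x y → Dec (Adj x y)
    symm   : ∀ {x y} → Adj x y → Adj y x
    irrefl : ∀ x → ¬ Adj x x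

PathAdj : ∀ {n} → Fin n → Fin n → Set
PathAdj x y = (suc (toℕ x) ≡ toℕ y) ⊎ (suc (toℕ y) ≡ toℕ x)

private
  n≢sucn : ∀ m → ¬ (suc m ≡ m)
  n≢sucn zero ()
  n≢sucn (suc m) e = n≢sucn m (suc-injective e)

  swap : ∀ {A B : Set} → A ⊎ B → B ⊎ A
  swap (inj₁ a) = inj₂ a
  swap (inj₂ b) = inj₁ b

PathGraph : (n : ℕ) → Graph n
PathGraph n = record
  { Adj    = PathAdj
  ; adj?   = λ x y → (suc (toℕ x) ≟ toℕ y) ⊎-dec (suc (toℕ y) ≟ toℕ x)
  ; symm   = swap
  ; irrefl = λ { x (inj₁ e) → n≢sucn (toℕ x) e ; x (inj₂ e) → n≢sucn (toℕ x) e }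
  }

∑ : ∀ n → (Fin n → ℕ) → ℕ
∑ zero    f = 0
∑ (suc n) f = f Fin.zero + ∑ n (λ i → f (Fin.suc i))


𝟙 : ∀ {A : Set} → Dec A → ℕ
𝟙 (yes _) = 1
𝟙 (no _)  = 0

-- A numbering is a bijection V(G) = Fin n → {1,…,n} (represented as Fin n,
-- i.e. shifted by one, which does not affect comparisons).
Numbering : ℕ → Set
Numbering n = Permutation′ n

-- The 2-path ⟨x,u,y⟩ (unordered pair {x,y}, represented once with toℕ x < toℕ y)
-- is a 2-path of G and is valid under π.
validInd : ∀ {n} → Graph n → Numbering n → Fin n → Fin n → Fin n → ℕ
validInd G π u x y =
  𝟙 ((toℕ x <? toℕ y)
     ×-dec (adj? u x ×-dec adj? u y)
     ×-dec (toℕ (π ⟨$⟩ʳ u) <? toℕ (π ⟨$⟩ʳ x))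
     ×-dec (toℕ (π ⟨$⟩ʳ u) <? toℕ (π ⟨$⟩ʳ y)))
  where open Graph G

validity : ∀ {n} → Graph n → Numbering n → ℕ
validity {n} G π = ∑ n λ u → ∑ n λ x → ∑ n λ y → validInd G π u x y

IsPhiMin : ∀ {n} → Graph n → ℕ → Set
IsPhiMin {n} G m = Σ (Numbering n) (λ π → validity G π ≡ m) × (∀ π → m ≤ validity G π)

IsPhiMax : ∀ {n} → Graph n → ℕ → Set
IsPhiMax {n} G m = Σ (Numbering n) (λ π → validity G π ≡ m) × (∀ π → validity G π ≤ m)

module Submission where

-- On a path only the 2-paths ⟨u−1, u, u+1⟩ exist, so φ_π(P_n) counts the interior
-- vertices that are local minima of π. Two adjacent vertices cannot both be local
-- minima, hence among the n − 2 interior vertices at most ⌈(n − 2)/2⌉ = ⌈n/2⌉ − 1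
-- are. The identity numbering has no local minimum, and swapping the values of the
-- pairs {0,1}, {2,3}, … makes every other interior vertex 1, 3, 5, … a local minimum.

open import Defs
open import Data.Nat using (ℕ; zero; suc; _+_; _∸_; _/_; _≤_; _<_; z≤n; s≤s; s<s; s<s⁻¹; ⌊_/2⌋; ⌈_/2⌉)
open import Data.Nat.Properties
open import Data.Nat.DivMod using (m/n≡1+[m∸n]/n)
open import Data.Product using (_×_; _,_; proj₁; proj₂)
open import Data.Sum using (_⊎_; inj₁; inj₂)
open import Data.Fin using (Fin; toℕ; fromℕ<) renaming (zero to fzero; suc to fsuc)
open import Data.Fin.Properties using (toℕ<n; toℕ-injective; fromℕ<-toℕ; toℕ-fromℕ<) renaming (suc-injective to fsuc-injective)
open import Data.Fin.Permutation using (_⟨$⟩ʳ_; permutation)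
open import Data.Empty using (⊥-elim)
open import Function using (_∘_; id)
open import Relation.Nullary using (Dec; yes; no; ¬_)
open import Relation.Nullary.Decidable using (_×-dec_)
open import Relation.Binary.PropositionalEquality
open ≡-Reasoning

∑-cong : ∀ n {f g : Fin n → ℕ} → (∀ i → f i ≡ g i) → ∑ n f ≡ ∑ n g
∑-cong zero    f≡g = refl
∑-cong (suc n) f≡g = cong₂ _+_ (f≡g fzero) (∑-cong n (f≡g ∘ fsuc))

∑-zero : ∀ n {f : Fin n → ℕ} → (∀ i → f i ≡ 0) → ∑ n f ≡ 0
∑-zero zero    f≡0 = refl
∑-zero (suc n) f≡0 = cong₂ _+_ (f≡0 fzero) (∑-zero n (f≡0 ∘ fsuc))

∑-single : ∀ n {f : Fin n → ℕ} (a : Fin n) → (∀ i → i ≢ a → f i ≡ 0) → ∑ n f ≡ f a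
∑-single (suc n) {f} fzero f≡0 = begin
  f fzero + ∑ n (f ∘ fsuc) ≡⟨ cong (f fzero +_) (∑-zero n (λ i → f≡0 (fsuc i) λ ())) ⟩
  f fzero + 0              ≡⟨ +-identityʳ (f fzero) ⟩
  f fzero                  ∎
∑-single (suc n) {f} (fsuc a) f≡0 = begin
  f fzero + ∑ n (f ∘ fsuc) ≡⟨ cong (_+ ∑ n (f ∘ fsuc)) (f≡0 fzero λ ()) ⟩
  ∑ n (f ∘ fsuc)           ≡⟨ ∑-single n a (λ i i≢a → f≡0 (fsuc i) (i≢a ∘ fsuc-injective)) ⟩
  f (fsuc a)               ∎

∑-snoc : ∀ n (h : ℕ → ℕ) → ∑ (suc n) (h ∘ toℕ) ≡ ∑ n (h ∘ toℕ) + h n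
∑-snoc zero    h = +-identityʳ (h 0)
∑-snoc (suc n) h = begin
  h 0 + ∑ (suc n) (h ∘ suc ∘ toℕ)         ≡⟨ cong (h 0 +_) (∑-snoc n (h ∘ suc)) ⟩
  h 0 + (∑ n (h ∘ suc ∘ toℕ) + h (suc n)) ≡⟨ +-assoc (h 0) _ (h (suc n)) ⟨
  h 0 + ∑ n (h ∘ suc ∘ toℕ) + h (suc n)   ∎

∑-≤-⌈/2⌉ : ∀ n (h : ℕ → ℕ) → (∀ i → h i + h (suc i) ≤ 1) → ∑ n (h ∘ toℕ) ≤ ⌈ n /2⌉
∑-≤-⌈/2⌉ zero          h adj = z≤n
∑-≤-⌈/2⌉ (suc zero)    h adj = ≤-trans (+-monoʳ-≤ (h 0) z≤n) (adj 0)
∑-≤-⌈/2⌉ (suc (suc n)) h adj = subst (_≤ suc ⌈ n /2⌉) (+-assoc (h 0) (h 1) _)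
  (+-mono-≤ (adj 0) (∑-≤-⌈/2⌉ n (h ∘ suc ∘ suc) (adj ∘ suc ∘ suc)))

evenInd : ℕ → ℕ
evenInd zero          = 1
evenInd (suc zero)    = 0
evenInd (suc (suc j)) = evenInd j

evenInd-0or1 : ∀ j → evenInd j ≡ 0 ⊎ evenInd j ≡ 1
evenInd-0or1 zero          = inj₂ refl
evenInd-0or1 (suc zero)    = inj₁ refl
evenInd-0or1 (suc (suc j)) = evenInd-0or1 j

∑-evenInd : ∀ n → ∑ n (evenInd ∘ toℕ) ≡ ⌈ n /2⌉
∑-evenInd zero          = refl
∑-evenInd (suc zero)    = refl
∑-evenInd (suc (suc n)) = cong suc (∑-evenInd n)

⌊n/2⌋≡n/2 : ∀ n → ⌊ n /2⌋ ≡ n / 2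
⌊n/2⌋≡n/2 zero          = refl
⌊n/2⌋≡n/2 (suc zero)    = refl
⌊n/2⌋≡n/2 (suc (suc n)) = trans (cong suc (⌊n/2⌋≡n/2 n)) (sym (m/n≡1+[m∸n]/n {suc (suc n)} (s≤s (s≤s z≤n))))

[3+k]/2∸1≡⌈k/2⌉ : ∀ k → (suc (suc k) + 1) / 2 ∸ 1 ≡ ⌈ k /2⌉
[3+k]/2∸1≡⌈k/2⌉ k = begin
  (suc (suc k) + 1) / 2 ∸ 1 ≡⟨ cong (_∸ 1) (⌊n/2⌋≡n/2 (suc (suc k) + 1)) ⟨
  ⌊ k + 1 /2⌋               ≡⟨ cong ⌊_/2⌋ (+-comm k 1) ⟩
  ⌈ k /2⌉                   ∎

𝟙-≡0 : ∀ {A : Set} (d : Dec A) → ¬ A → 𝟙 d ≡ 0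
𝟙-≡0 (yes a) ¬a = ⊥-elim (¬a a)
𝟙-≡0 (no _)  _  = refl

𝟙-≡1 : ∀ {A : Set} (d : Dec A) → A → 𝟙 d ≡ 1
𝟙-≡1 (yes _) _ = refl
𝟙-≡1 (no ¬a) a = ⊥-elim (¬a a)

𝟙-≤1 : ∀ {A : Set} (d : Dec A) → 𝟙 d ≤ 1
𝟙-≤1 (yes _) = s≤s z≤n
𝟙-≤1 (no _)  = z≤n

𝟙-cong : ∀ {A B : Set} (a : Dec A) (b : Dec B) → (A → B) → (B → A) → 𝟙 a ≡ 𝟙 b
𝟙-cong (yes _) (yes _) _ _ = refl
𝟙-cong (yes a) (no ¬b) f _ = ⊥-elim (¬b (f a))
𝟙-cong (no ¬a) (yes b) _ g = ⊥-elim (¬a (g b))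
𝟙-cong (no _)  (no _)  _ _ = refl

𝟙-+-≤1 : ∀ {A B : Set} (a : Dec A) (b : Dec B) → (A → ¬ B) → 𝟙 a + 𝟙 b ≤ 1
𝟙-+-≤1 (yes a) (yes b) a⇒¬b = ⊥-elim (a⇒¬b a b)
𝟙-+-≤1 (yes _) (no _)  _    = s≤s z≤n
𝟙-+-≤1 (no _)  b       _    = 𝟙-≤1 b

module LocalMinima (n : ℕ) (π : Numbering n) where

  -- π on ℕ-indices; the junk value 0 at i ≥ n never matters, as LocalMin j demands suc (suc j) < n.
  rank : ℕ → ℕ
  rank i with i <? n
  ... | yes i<n = toℕ (π ⟨$⟩ʳ fromℕ< i<n)
  ... | no _    = 0

  rank-toℕ : ∀ x → rank (toℕ x) ≡ toℕ (π ⟨$⟩ʳ x)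
  rank-toℕ x with toℕ x <? n
  ... | yes x<n = cong (λ z → toℕ (π ⟨$⟩ʳ z)) (fromℕ<-toℕ x x<n)
  ... | no x≮n  = ⊥-elim (x≮n (toℕ<n x))

  rank-fromℕ< : ∀ {i} (i<n : i < n) → rank i ≡ toℕ (π ⟨$⟩ʳ fromℕ< i<n)
  rank-fromℕ< i<n = trans (cong rank (sym (toℕ-fromℕ< i<n))) (rank-toℕ (fromℕ< i<n))

  -- Vertex suc j is an interior vertex and a local minimum of π.
  LocalMin : ℕ → Set
  LocalMin j = suc (suc j) < n × rank (suc j) < rank j × rank (suc j) < rank (suc (suc j))

  localMin? : ∀ j → Dec (LocalMin j)
  localMin? j = (suc (suc j) <? n) ×-dec (rank (suc j) <? rank j) ×-dec (rank (suc j) <? rank (suc (suc j)))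

  minInd : ℕ → ℕ
  minInd j = 𝟙 (localMin? j)

  minInd-adjacent : ∀ j → minInd j + minInd (suc j) ≤ 1
  minInd-adjacent j = 𝟙-+-≤1 (localMin? j) (localMin? (suc j)) λ min₁ min₂ →
    <-asym (proj₂ (proj₂ min₁)) (proj₁ (proj₂ min₂))

  minInd-last : ∀ j → n ≤ suc (suc j) → minInd j ≡ 0
  minInd-last j n≤2+j = 𝟙-≡0 (localMin? j) λ min → <-irrefl refl (<-≤-trans (proj₁ min) n≤2+j)

  centreInd : ℕ → ℕ
  centreInd zero    = 0
  centreInd (suc j) = minInd j

  valid : Fin n → Fin n → Fin n → ℕ
  valid = validInd (PathGraph n) π

  valid-off-centre : ∀ u x y → ¬ (suc (toℕ x) ≡ toℕ u × toℕ y ≡ suc (toℕ u)) → valid u x y ≡ 0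
  valid-off-centre u x y off = 𝟙-≡0 _ λ
    { (x<y , (inj₂ x+1≡u , inj₁ u+1≡y) , _) → off (x+1≡u , sym u+1≡y)
    ; (x<y , (inj₂ x+1≡u , inj₂ y+1≡u) , _) → <-irrefl (suc-injective (trans x+1≡u (sym y+1≡u))) x<y
    ; (x<y , (inj₁ u+1≡x , inj₁ u+1≡y) , _) → <-irrefl (trans (sym u+1≡x) u+1≡y) x<y
    ; (x<y , (inj₁ u+1≡x , inj₂ y+1≡u) , _) →
        <-asym x<y (subst (toℕ y <_) (trans (cong suc y+1≡u) u+1≡x) (<-trans (n<1+n _) (n<1+n _)))
    }

  valid-centre : ∀ u x y → suc (toℕ x) ≡ toℕ u → toℕ y ≡ suc (toℕ u) → valid u x y ≡ minInd (toℕ x)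
  valid-centre u x y x+1≡u y≡u+1 = 𝟙-cong _ (localMin? (toℕ x)) to from
    where
    y≡x+2 : toℕ y ≡ suc (suc (toℕ x))
    y≡x+2 = trans y≡u+1 (cong suc (sym x+1≡u))
    rank-u : rank (suc (toℕ x)) ≡ toℕ (π ⟨$⟩ʳ u)
    rank-u = trans (cong rank x+1≡u) (rank-toℕ u)
    rank-y : rank (suc (suc (toℕ x))) ≡ toℕ (π ⟨$⟩ʳ y)
    rank-y = trans (cong rank (sym y≡x+2)) (rank-toℕ y)
    to : _ → LocalMin (toℕ x)
    to (_ , _ , u<x , u<y) =
      subst (_< n) y≡x+2 (toℕ<n y) ,
      subst₂ _<_ (sym rank-u) (sym (rank-toℕ x)) u<x ,
      subst₂ _<_ (sym rank-u) (sym rank-y) u<y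
    from : LocalMin (toℕ x) → _
    from (_ , u<x , u<y) =
      subst (toℕ x <_) (sym y≡x+2) (<-trans (n<1+n _) (n<1+n _)) ,
      (inj₂ x+1≡u , inj₁ (sym y≡u+1)) ,
      subst₂ _<_ rank-u (rank-toℕ x) u<x ,
      subst₂ _<_ rank-u rank-y u<y

  valid-at : ∀ u {i} → toℕ u ≡ i → ∑ n (λ x → ∑ n (λ y → valid u x y)) ≡ centreInd i
  valid-at u {zero} u≡ = ∑-zero n λ x → ∑-zero n λ y → valid-off-centre u x y λ (x+1≡u , _) →
    1+n≢0 (trans x+1≡u u≡)
  valid-at u {suc j} u≡ with n ≤? suc (suc j)
  ... | yes n≤2+j = begin
    ∑ n (λ x → ∑ n (λ y → valid u x y)) ≡⟨ ∑-zero n (λ x → ∑-zero n λ y → valid-off-centre u x y λ (_ , y≡u+1) →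
                                              <-irrefl refl (<-≤-trans (subst (_< n) (trans y≡u+1 (cong suc u≡)) (toℕ<n y)) n≤2+j)) ⟩
    0                                   ≡⟨ minInd-last j n≤2+j ⟨
    minInd j                            ∎
  ... | no n≰2+j = begin
    ∑ n (λ x → ∑ n (λ y → valid u x y)) ≡⟨ ∑-single n x₀ (λ x x≢x₀ → ∑-zero n λ y → valid-off-centre u x y λ (x+1≡u , _) →
                                              x≢x₀ (toℕ-injective (trans (suc-injective (trans x+1≡u u≡)) (sym x₀≡j)))) ⟩
    ∑ n (λ y → valid u x₀ y)            ≡⟨ ∑-single n y₀ (λ y y≢y₀ → valid-off-centre u x₀ y λ (_ , y≡u+1) →
                                              y≢y₀ (toℕ-injective (trans y≡u+1 (trans (cong suc u≡) (sym y₀≡2+j))))) ⟩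
    valid u x₀ y₀                       ≡⟨ valid-centre u x₀ y₀ (trans (cong suc x₀≡j) (sym u≡))
                                                               (trans y₀≡2+j (cong suc (sym u≡))) ⟩
    minInd (toℕ x₀)                     ≡⟨ cong minInd x₀≡j ⟩
    minInd j                            ∎
    where
    2+j<n : suc (suc j) < n
    2+j<n = ≰⇒> n≰2+j
    j<n : j < n
    j<n = <-trans (n<1+n j) (<-trans (n<1+n (suc j)) 2+j<n)
    x₀ y₀ : Fin n
    x₀ = fromℕ< j<n
    y₀ = fromℕ< 2+j<n
    x₀≡j : toℕ x₀ ≡ j
    x₀≡j = toℕ-fromℕ< j<n
    y₀≡2+j : toℕ y₀ ≡ suc (suc j)
    y₀≡2+j = toℕ-fromℕ< 2+j<n

validity≡∑minInd : ∀ k (π : Numbering (suc (suc k))) →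
  validity (PathGraph (suc (suc k))) π ≡ ∑ k (LocalMinima.minInd (suc (suc k)) π ∘ toℕ)
validity≡∑minInd k π = begin
  validity (PathGraph (suc (suc k))) π  ≡⟨ ∑-cong (suc (suc k)) (λ u → valid-at u refl) ⟩
  ∑ (suc k) (minInd ∘ toℕ)              ≡⟨ ∑-snoc k minInd ⟩
  ∑ k (minInd ∘ toℕ) + minInd k         ≡⟨ cong (∑ k (minInd ∘ toℕ) +_) (minInd-last k ≤-refl) ⟩
  ∑ k (minInd ∘ toℕ) + 0                ≡⟨ +-identityʳ _ ⟩
  ∑ k (minInd ∘ toℕ)                    ∎
  where open LocalMinima (suc (suc k)) π

validity-≤ : ∀ k (π : Numbering (suc (suc k))) → validity (PathGraph (suc (suc k))) π ≤ ⌈ k /2⌉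
validity-≤ k π = subst (_≤ ⌈ k /2⌉) (sym (validity≡∑minInd k π))
  (∑-≤-⌈/2⌉ k minInd minInd-adjacent)
  where open LocalMinima (suc (suc k)) π

idNumbering : ∀ n → Numbering n
idNumbering n = permutation id id (λ _ → refl) (λ _ → refl)

validity-idNumbering : ∀ k → validity (PathGraph (suc (suc k))) (idNumbering (suc (suc k))) ≡ 0
validity-idNumbering k = trans (validity≡∑minInd k (idNumbering n)) (∑-zero k λ i → minInd≡0 (toℕ i))
  where
  n : ℕ
  n = suc (suc k)
  open LocalMinima n (idNumbering n)
  rank≡id : ∀ {i} → i < n → rank i ≡ i
  rank≡id i<n = trans (rank-fromℕ< i<n) (toℕ-fromℕ< i<n)
  minInd≡0 : ∀ j → minInd j ≡ 0
  minInd≡0 j = 𝟙-≡0 (localMin? j) λ (2+j<n , r₁<r₀ , _) →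
    let 1+j<n = <-trans (n<1+n (suc j)) 2+j<n in
    <-asym r₁<r₀ (subst₂ _<_ (sym (rank≡id (<-trans (n<1+n j) 1+j<n))) (sym (rank≡id 1+j<n)) (n<1+n j))

swapPairs : ∀ n → Fin n → Fin n
swapPairs (suc zero)    fzero           = fzero
swapPairs (suc (suc n)) fzero           = fsuc fzero
swapPairs (suc (suc n)) (fsuc fzero)    = fzero
swapPairs (suc (suc n)) (fsuc (fsuc i)) = fsuc (fsuc (swapPairs n i))

swapPairs-involutive : ∀ n i → swapPairs n (swapPairs n i) ≡ i
swapPairs-involutive (suc zero)    fzero           = refl
swapPairs-involutive (suc (suc n)) fzero           = refl
swapPairs-involutive (suc (suc n)) (fsuc fzero)    = refl
swapPairs-involutive (suc (suc n)) (fsuc (fsuc i)) = cong (fsuc ∘ fsuc) (swapPairs-involutive n i)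

swapPairsℕ : ℕ → ℕ → ℕ
swapPairsℕ (suc (suc n)) zero          = 1
swapPairsℕ (suc (suc n)) (suc zero)    = 0
swapPairsℕ (suc (suc n)) (suc (suc i)) = suc (suc (swapPairsℕ n i))
swapPairsℕ _             i             = i

toℕ-swapPairs : ∀ n i → toℕ (swapPairs n i) ≡ swapPairsℕ n (toℕ i)
toℕ-swapPairs (suc zero)    fzero           = refl
toℕ-swapPairs (suc (suc n)) fzero           = refl
toℕ-swapPairs (suc (suc n)) (fsuc fzero)    = refl
toℕ-swapPairs (suc (suc n)) (fsuc (fsuc i)) = cong (suc ∘ suc) (toℕ-swapPairs n i)

swapPairsℕ-even : ∀ n j → suc (suc j) < n → evenInd j ≡ 1 →
  swapPairsℕ n (suc j) < swapPairsℕ n j × swapPairsℕ n (suc j) < swapPairsℕ n (suc (suc j))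
swapPairsℕ-even (suc zero)    _             (s≤s ()) _
swapPairsℕ-even (suc (suc n)) zero          _        _    = s≤s z≤n , s≤s z≤n
swapPairsℕ-even (suc (suc n)) (suc (suc j)) 4+j<n    even =
  let (s₁<s₀ , s₁<s₂) = swapPairsℕ-even n j (s<s⁻¹ (s<s⁻¹ 4+j<n)) even
  in s<s (s<s s₁<s₀) , s<s (s<s s₁<s₂)

swapPairsℕ-odd : ∀ n j → suc (suc j) < n → evenInd j ≡ 0 → ¬ (swapPairsℕ n (suc j) < swapPairsℕ n j)
swapPairsℕ-odd (suc zero)    _             (s≤s ()) _
swapPairsℕ-odd (suc (suc n)) (suc zero)    _        _   ()
swapPairsℕ-odd (suc (suc n)) (suc (suc j)) 4+j<n    odd s₁<s₀ =
  swapPairsℕ-odd n j (s<s⁻¹ (s<s⁻¹ 4+j<n)) odd (s<s⁻¹ (s<s⁻¹ s₁<s₀))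

swapPairsNumbering : ∀ n → Numbering n
swapPairsNumbering n = permutation (swapPairs n) (swapPairs n) (swapPairs-involutive n) (swapPairs-involutive n)

validity-swapPairsNumbering : ∀ k → validity (PathGraph (suc (suc k))) (swapPairsNumbering (suc (suc k))) ≡ ⌈ k /2⌉
validity-swapPairsNumbering k = begin
  validity (PathGraph n) (swapPairsNumbering n) ≡⟨ validity≡∑minInd k (swapPairsNumbering n) ⟩
  ∑ k (minInd ∘ toℕ)                            ≡⟨ ∑-cong k (λ i → minInd≡evenInd (toℕ i) (s<s (s<s (toℕ<n i)))) ⟩
  ∑ k (evenInd ∘ toℕ)                           ≡⟨ ∑-evenInd k ⟩
  ⌈ k /2⌉                                       ∎
  where
  n : ℕ
  n = suc (suc k)
  open LocalMinima n (swapPairsNumbering n)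
  rank≡swapPairsℕ : ∀ {i} → i < n → rank i ≡ swapPairsℕ n i
  rank≡swapPairsℕ i<n = trans (rank-fromℕ< i<n)
    (trans (toℕ-swapPairs n (fromℕ< i<n)) (cong (swapPairsℕ n) (toℕ-fromℕ< i<n)))
  ranks : ∀ {j} → suc (suc j) < n →
    rank j ≡ swapPairsℕ n j × rank (suc j) ≡ swapPairsℕ n (suc j) × rank (suc (suc j)) ≡ swapPairsℕ n (suc (suc j))
  ranks {j} 2+j<n =
    let 1+j<n = <-trans (n<1+n (suc j)) 2+j<n
    in rank≡swapPairsℕ (<-trans (n<1+n j) 1+j<n) , rank≡swapPairsℕ 1+j<n , rank≡swapPairsℕ 2+j<n
  minInd≡evenInd : ∀ j → suc (suc j) < n → minInd j ≡ evenInd j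
  minInd≡evenInd j 2+j<n with ranks 2+j<n | evenInd-0or1 j
  ... | r₀ , r₁ , _ | inj₁ odd = trans (𝟙-≡0 (localMin? j) λ (_ , r₁<r₀ , _) →
    swapPairsℕ-odd n j 2+j<n odd (subst₂ _<_ r₁ r₀ r₁<r₀)) (sym odd)
  ... | r₀ , r₁ , r₂ | inj₂ even =
    let (s₁<s₀ , s₁<s₂) = swapPairsℕ-even n j 2+j<n even
    in trans (𝟙-≡1 (localMin? j) (2+j<n , subst₂ _<_ (sym r₁) (sym r₀) s₁<s₀ , subst₂ _<_ (sym r₁) (sym r₂) s₁<s₂))
             (sym even)

lemma1 : ∀ (n : ℕ) → 3 ≤ n →
    IsPhiMin (PathGraph n) 0 × IsPhiMax (PathGraph n) (((n + 1) / 2) ∸ 1)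
lemma1 (suc zero)    (s≤s ())
lemma1 (suc (suc k)) _ =
  ((idNumbering n , validity-idNumbering k) , λ _ → z≤n) ,
  ((swapPairsNumbering n , trans (validity-swapPairsNumbering k) (sym ([3+k]/2∸1≡⌈k/2⌉ k))) ,
   λ π → subst (validity (PathGraph n) π ≤_) (sym ([3+k]/2∸1≡⌈k/2⌉ k)) (validity-≤ k π))
  where
  n : ℕ
  n = suc (suc k)
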